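{- Let $m,n$ be positive integers, $t$ a nonnegative integer, and $\alpha=(a_1,\dots,a_m)\in[n]^m$. Under the $t$-metered parking scheme, for every $i\in[m]$: if car $i$ parks, say in spot $p_i$, then its displacement satisfies $d_i(\alpha)=p_i-a_i\le t$; and if car $i$ fails to park, then $a_i\ge n-t+1$.
   Context: $[n]=\{1,\dots,n\}$. The $t$-metered parking scheme for $\alpha\in[n]^m$: there are $n$ spots $1,\dots,n$; cars $1,\dots,m$ arrive in order; car $i$ drives to spot $a_i$, parks there if it is unoccupied, and otherwise parks in the first unoccupied spot numbered greater than $a_i$; if there is none, car $i$ fails to park (it never occupies a spot) and the process continues with the next car. After car $j$'s turn, car $j-t$ (if $j-t\ge1$ and it is parked) leaves, vacating its spot; thus at most $t$ cars are parked when any car arrives. The displacement of a parked car $i$ is $d_i(\alpha)=p_i-a_i$, where $p_i$ is the spot in which it parks. -}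

module Defs where

open import Data.Nat using (ℕ; zero; suc; _+_; _∸_; _≤_; _<_; _≟_; _≤?_)
open import Data.Bool using (Bool; true; false; if_then_else_)
open import Data.Bool.ListAction using (any)
open import Data.List using (List; []; _∷_; filter)
open import Data.Maybe using (Maybe; just; nothing)
open import Data.Product using (_×_; _,_; proj₁; proj₂)
open import Data.Fin using (Fin; toℕ; fromℕ<)
open import Data.Fin.Properties using ()
open import Relation.Nullary using (yes; no)
open import Relation.Nullary.Decidable using (⌊_⌋; ¬?)

-- Conventions: spots are the natural numbers 1,…,n; a preference list
-- α ∈ [n]^m is a function Fin m → ℕ whose values lie in [1,n]
-- (imposed as a hypothesis in the statement); the paper's car i is the
-- element of Fin m with toℕ = i - 1 (0-based indices internally).

-- Occupied spots: list of (car index (0-based), spot) of currently parked cars.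
Occupancy : Set
Occupancy = List (ℕ × ℕ)

occupied : Occupancy → ℕ → Bool
occupied occ s = any (λ cs → ⌊ proj₂ cs ≟ s ⌋) occ

firstFreeFrom : Occupancy → ℕ → ℕ → Maybe ℕ
firstFreeFrom occ s zero = nothing
firstFreeFrom occ s (suc k) =
  if occupied occ s then firstFreeFrom occ (suc s) k else just s

parkSpot : ℕ → Occupancy → ℕ → Maybe ℕ
parkSpot n occ a = firstFreeFrom occ a (suc n ∸ a)

leave : ℕ → Occupancy → Occupancy
leave c occ = filter (λ cs → ¬? (proj₁ cs ≟ c)) occ

arrive : ℕ → ℕ → ℕ → Occupancy → Occupancy
arrive n j a occ with parkSpot n occ a
... | just p  = (j , p) ∷ occ
... | nothing = occ

depart : ℕ → ℕ → Occupancy → Occupancy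
depart t j occ with t ≤? j
... | yes _ = leave (j ∸ t) occ
... | no _  = occ

stateBefore : (m n t : ℕ) → (Fin m → ℕ) → (j : ℕ) → j ≤ m → Occupancy
stateBefore m n t α zero _ = []
stateBefore m n t α (suc j) j<m =
  depart t j (arrive n j (α (fromℕ< j<m))
               (stateBefore m n t α j (Data.Nat.Properties.<⇒≤ j<m)))
  where import Data.Nat.Properties

parkOutcome : (m n t : ℕ) → (Fin m → ℕ) → Fin m → Maybe ℕ
parkOutcome m n t α i =
  parkSpot n (stateBefore m n t α (toℕ i) (Data.Fin.Properties.toℕ≤n i)) (α i)
  where import Data.Fin.Properties

-- When car i arrives, the only parked cars are among cars i − t, …, i − 1, so at most t
-- spots are occupied. A car passes over occupied spots only, all distinct, so it is
-- displaced by at most t; a car that fails to park has found all n + 1 − aᵢ spots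
-- aᵢ, …, n occupied, so n + 1 − aᵢ ≤ t.
module Submission where

open import Defs
open import Data.Nat using (ℕ; zero; suc; _+_; _∸_; _≤_; _≥_; _<_; z≤n; s≤s; _≟_; _≤?_)
open import Data.Nat.Properties
open import Data.Product using (_×_; _,_; proj₁; proj₂; ∃-syntax)
open import Data.Fin using (Fin; toℕ; fromℕ<)
open import Data.Fin.Properties using (toℕ<n; toℕ≤n; toℕ-injective; injective⇒≤)
open import Data.Maybe using (just; nothing)
open import Data.Bool using (true; false)
open import Data.Bool.Properties using (T-≡)
open import Data.List using (length; lookup; _∷_; [])
open import Data.List.Properties using (filter-accept; filter-reject)
open import Data.List.Relation.Unary.Any using (index)
open import Data.List.Relation.Unary.Any.Properties using (any⁻; lookup-result)
open import Function using (_$_)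
open import Function.Bundles using (Equivalence)
open import Relation.Nullary using (yes; no)
open import Relation.Nullary.Decidable using (toWitness; ¬?)
open import Relation.Binary.PropositionalEquality

m∸n≤o⇒m∸o≤n : ∀ {m n o} → m ∸ n ≤ o → m ∸ o ≤ n
m∸n≤o⇒m∸o≤n {m} {n} {o} le = m≤n+o⇒m∸n≤o m o
  (≤-trans (m≤n+m∸n m n) (≤-trans (+-monoʳ-≤ n le) (≤-reflexive (+-comm n o))))

occupied⇒∃index : ∀ occ {s} → occupied occ s ≡ true → ∃[ i ] proj₂ (lookup occ i) ≡ s
occupied⇒∃index occ h = index w , toWitness (lookup-result w)
  where w = any⁻ _ occ (Equivalence.from T-≡ h)

OccupiedFrom : Occupancy → ℕ → ℕ → Set
OccupiedFrom occ s d = ∀ k → k < d → occupied occ (s + k) ≡ true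

occupiedFrom-suc : ∀ occ s {d} → occupied occ s ≡ true →
                   OccupiedFrom occ (suc s) d → OccupiedFrom occ s (suc d)
occupiedFrom-suc occ s hs hd zero    _         =
  subst (λ x → occupied occ x ≡ true) (sym (+-identityʳ s)) hs
occupiedFrom-suc occ s hs hd (suc k) (s≤s k<d) =
  subst (λ x → occupied occ x ≡ true) (sym (+-suc s k)) (hd k k<d)

-- The d spots s, …, s + d − 1 sit at distinct positions of the list.
occupiedFrom⇒≤length : ∀ occ s d → OccupiedFrom occ s d → d ≤ length occ
occupiedFrom⇒≤length occ s d h = injective⇒≤ position-injective
  where
    position : Fin d → Fin (length occ)
    position k = proj₁ (occupied⇒∃index occ (h (toℕ k) (toℕ<n k)))

    spot-position : ∀ k → proj₂ (lookup occ (position k)) ≡ s + toℕ k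
    spot-position k = proj₂ (occupied⇒∃index occ (h (toℕ k) (toℕ<n k)))

    position-injective : ∀ {k l} → position k ≡ position l → k ≡ l
    position-injective {k} {l} eq = toℕ-injective (+-cancelˡ-≡ s _ _ (begin
      s + toℕ k                       ≡⟨ sym (spot-position k) ⟩
      proj₂ (lookup occ (position k)) ≡⟨ cong (λ i → proj₂ (lookup occ i)) eq ⟩
      proj₂ (lookup occ (position l)) ≡⟨ spot-position l ⟩
      s + toℕ l                       ∎))
      where open ≡-Reasoning

firstFreeFrom-just : ∀ occ s k {p} → firstFreeFrom occ s k ≡ just p →
                     ∃[ d ] p ≡ s + d × OccupiedFrom occ s d
firstFreeFrom-just occ s (suc k) h with occupied occ s in hs
firstFreeFrom-just occ s (suc k) refl | false = 0 , sym (+-identityʳ s) , λ _ ()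
firstFreeFrom-just occ s (suc k) h    | true with firstFreeFrom-just occ (suc s) k h
... | d , refl , hd = suc d , sym (+-suc s d) , occupiedFrom-suc occ s hs hd

firstFreeFrom-nothing : ∀ occ s k → firstFreeFrom occ s k ≡ nothing → OccupiedFrom occ s k
firstFreeFrom-nothing occ s zero    h = λ _ ()
firstFreeFrom-nothing occ s (suc k) h with occupied occ s in hs
firstFreeFrom-nothing occ s (suc k) () | false
firstFreeFrom-nothing occ s (suc k) h  | true =
  occupiedFrom-suc occ s hs (firstFreeFrom-nothing occ (suc s) k h)

-- Arriving cars are consed on, so car indices strictly decrease along an occupancy;
-- CarsIn lo hi occ says they moreover lie in [lo, hi).
data CarsIn (lo : ℕ) : ℕ → Occupancy → Set where
  []  : ∀ {hi} → CarsIn lo hi []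
  _∷_ : ∀ {hi c s occ} → lo ≤ c × c < hi → CarsIn lo c occ → CarsIn lo hi ((c , s) ∷ occ)

CarsIn-length : ∀ {lo hi occ} → CarsIn lo hi occ → length occ ≤ hi ∸ lo
CarsIn-length []                        = z≤n
CarsIn-length {lo} ((lo≤c , c<hi) ∷ cs) =
  ≤-trans (s≤s (CarsIn-length cs))
          (≤-trans (≤-reflexive (sym (+-∸-assoc 1 lo≤c))) (∸-monoˡ-≤ lo c<hi))

CarsIn-weaken : ∀ {lo lo′ hi hi′ occ} → lo′ ≤ lo → hi ≤ hi′ →
                CarsIn lo hi occ → CarsIn lo′ hi′ occ
CarsIn-weaken _  _  []                   = []
CarsIn-weaken le ge ((lo≤c , c<hi) ∷ cs) =
  (≤-trans le lo≤c , ≤-trans c<hi ge) ∷ CarsIn-weaken le ≤-refl cs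

CarsIn-leave : ∀ {lo hi occ} → CarsIn lo hi occ → CarsIn (suc lo) hi (leave lo occ)
CarsIn-leave [] = []
CarsIn-leave {lo} (_∷_ {c = c} {s} {occ} (lo≤c , c<hi) cs) with c ≟ lo
... | yes c≡lo rewrite filter-reject (λ cs → ¬? (proj₁ cs ≟ lo)) {c , s} {occ} (_$ c≡lo) =
  CarsIn-weaken ≤-refl (<⇒≤ c<hi) (CarsIn-leave cs)
... | no c≢lo rewrite filter-accept (λ cs → ¬? (proj₁ cs ≟ lo)) {c , s} {occ} c≢lo =
  (≤∧≢⇒< lo≤c (≢-sym c≢lo) , c<hi) ∷ CarsIn-leave cs

CarsIn-arrive : ∀ {n j a lo occ} → lo ≤ j → CarsIn lo j occ →
                CarsIn lo (suc j) (arrive n j a occ)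
CarsIn-arrive {n} {j} {a} {occ = occ} lo≤j cs with parkSpot n occ a
... | just _  = (lo≤j , ≤-refl) ∷ cs
... | nothing = CarsIn-weaken ≤-refl (n≤1+n j) cs

CarsIn-depart : ∀ {t j occ} → CarsIn (j ∸ t) (suc j) occ →
                CarsIn (suc j ∸ t) (suc j) (depart t j occ)
CarsIn-depart {t} {j} {occ} cs with t ≤? j
... | yes t≤j = subst (λ lo → CarsIn lo (suc j) (leave (j ∸ t) occ))
                      (sym (+-∸-assoc 1 t≤j)) (CarsIn-leave cs)
... | no t≰j  = subst (λ lo → CarsIn lo (suc j) occ)
                      (sym (m≤n⇒m∸n≡0 (≰⇒> t≰j))) (CarsIn-weaken z≤n ≤-refl cs)

stateBefore-CarsIn : ∀ m n t α j (j≤m : j ≤ m) → CarsIn (j ∸ t) j (stateBefore m n t α j j≤m)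
stateBefore-CarsIn m n t α zero    _   = []
stateBefore-CarsIn m n t α (suc j) j<m =
  CarsIn-depart {t} (CarsIn-arrive {n} {a = α (fromℕ< j<m)} (m∸n≤m j t)
                      (stateBefore-CarsIn m n t α j (<⇒≤ j<m)))

stateBefore-length : ∀ m n t α j (j≤m : j ≤ m) → length (stateBefore m n t α j j≤m) ≤ t
stateBefore-length m n t α j j≤m =
  ≤-trans (CarsIn-length (stateBefore-CarsIn m n t α j j≤m)) (m∸n≤o⇒m∸o≤n ≤-refl)

proposition2p11 : (m n t : ℕ) → 1 ≤ m → 1 ≤ n → (α : Fin m → ℕ)
    → (∀ i → 1 ≤ α i × α i ≤ n)
    → ∀ i → (∀ p → parkOutcome m n t α i ≡ just p → p ∸ α i ≤ t)
          × (parkOutcome m n t α i ≡ nothing → α i ≥ n + 1 ∸ t)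
proposition2p11 m n t _ _ α _ i = displacement≤t , failure⇒late
  where
    occ = stateBefore m n t α (toℕ i) (toℕ≤n i)
    a = α i

    few-parked : length occ ≤ t
    few-parked = stateBefore-length m n t α (toℕ i) (toℕ≤n i)

    displacement≤t : ∀ p → parkSpot n occ a ≡ just p → p ∸ a ≤ t
    displacement≤t p parks with firstFreeFrom-just occ a (suc n ∸ a) parks
    ... | d , refl , passed = subst (_≤ t) (sym (m+n∸m≡n a d))
                                (≤-trans (occupiedFrom⇒≤length occ a d passed) few-parked)

    failure⇒late : parkSpot n occ a ≡ nothing → a ≥ n + 1 ∸ t
    failure⇒late fails = subst (λ x → x ∸ t ≤ a) (+-comm 1 n) (m∸n≤o⇒m∸o≤n
      (≤-trans (occupiedFrom⇒≤length occ a _ (firstFreeFrom-nothing occ a _ fails)) few-parked))
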